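{- An element $x$ of an algebraic dcpo $D$ is sharp if and only if for every compact element $c\in D$ it is decidable whether $c\sqsubseteq x$.
   Context: We work constructively: informal set theory without excluded middle or choice. A dcpo is a poset in which every directed subset (inhabited, any two elements have an upper bound in it) has a supremum. $x\ll y$ if for every directed $S$ with $y\sqsubseteq\bigsqcup S$ some $s\in S$ has $x\sqsubseteq s$. An element $c$ is compact if $c\ll c$; $D$ is algebraic if for every $x$ the set $\{c\mid c\text{ compact},\ c\sqsubseteq x\}$ is directed with supremum $x$. An element $x$ is sharp if for all $y,z$ with $y\ll z$, $y\ll x$ or $\neg(z\sqsubseteq x)$. A proposition $P$ is decidable if $P\vee\neg P$. -}

module Defs where

open import Level using (Level; _⊔_; suc)
open import Data.Product using (Σ; ∃; _×_; _,_)
open import Data.Sum using (_⊎_)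
open import Relation.Nullary using (¬_; Dec)
open import Relation.Binary.Bundles using (Poset)

module _ {c ℓ₁ ℓ₂ : Level} (P : Poset c ℓ₁ ℓ₂) (s : Level) where
  open Poset P renaming (Carrier to D; _≤_ to _⊑_)

  Subset : Set (c ⊔ suc s)
  Subset = D → Set s

  IsDirected : Subset → Set (c ⊔ ℓ₂ ⊔ s)
  IsDirected S =
    (Σ D λ x → S x) ×
    (∀ x y → S x → S y → Σ D λ z → S z × (x ⊑ z) × (y ⊑ z))

  IsUpperBound : Subset → D → Set (c ⊔ ℓ₂ ⊔ s)
  IsUpperBound S u = ∀ x → S x → x ⊑ u

  IsSupremum : Subset → D → Set (c ⊔ ℓ₂ ⊔ s)
  IsSupremum S u = IsUpperBound S u × (∀ v → IsUpperBound S v → u ⊑ v)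

record DCPO (c ℓ₁ ℓ₂ s : Level) : Set (suc (c ⊔ ℓ₁ ⊔ ℓ₂ ⊔ s)) where
  field
    poset : Poset c ℓ₁ ℓ₂
  open Poset poset public renaming (Carrier to D; _≤_ to _⊑_)
  field
    ⨆ : (S : Subset poset s) → IsDirected poset s S → D
    ⨆-isSup : (S : Subset poset s) (δ : IsDirected poset s S) →
              IsSupremum poset s S (⨆ S δ)

module _ {c ℓ₁ ℓ₂ s : Level} (𝒟 : DCPO c ℓ₁ ℓ₂ s) where
  open DCPO 𝒟

  _≪_ : D → D → Set (c ⊔ ℓ₂ ⊔ suc s)
  x ≪ y = (S : Subset poset s) (δ : IsDirected poset s S) →
          y ⊑ ⨆ S δ → Σ D λ t → S t × (x ⊑ t)

  IsCompact : D → Set (c ⊔ ℓ₂ ⊔ suc s)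
  IsCompact x = x ≪ x

  -- An algebraic dcpo: for every x, {c | c compact, c ⊑ x} is directed with
  -- supremum x.  (The subset lives in level s, so we require the compact
  -- approximants to be given by a predicate of level s.)
  record IsAlgebraic : Set (suc (c ⊔ ℓ₂ ⊔ suc s)) where
    field
      K↓ : D → Subset poset s
      K↓-spec : ∀ x y → (K↓ x y → IsCompact y × (y ⊑ x)) × (IsCompact y × (y ⊑ x) → K↓ x y)
      K↓-directed : ∀ x → IsDirected poset s (K↓ x)
      K↓-sup : ∀ x → IsSupremum poset s (K↓ x) x

  IsSharp : D → Set (c ⊔ ℓ₂ ⊔ suc s)
  IsSharp x = ∀ y z → y ≪ z → (y ≪ x) ⊎ (¬ (z ⊑ x))

-- In an algebraic dcpo every instance y ≪ z is witnessed by a compact k with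
-- y ⊑ k ⊑ z, and for compact k the relations k ≪ x and k ⊑ x coincide.  So
-- sharpness of x reduces to its instances (k, k) with k compact, where it says
-- precisely that k ⊑ x is decided.
module Submission where

open import Defs
open import Level using (Level)
open import Relation.Nullary using (Dec; yes; no)
open import Function.Bundles using (_⇔_; mk⇔)
open import Data.Product using (Σ; _×_; _,_; proj₁; proj₂)
open import Data.Sum using (inj₁; inj₂; [_,_]′)

module WayBelow {c ℓ₁ ℓ₂ s : Level} (𝒟 : DCPO c ℓ₁ ℓ₂ s) where
  open DCPO 𝒟

  ⊑-≪-⊑-trans : ∀ {a b c d} → a ⊑ b → _≪_ 𝒟 b c → c ⊑ d → _≪_ 𝒟 a d
  ⊑-≪-⊑-trans a⊑b b≪c c⊑d S δ d⊑⨆S with b≪c S δ (trans c⊑d d⊑⨆S)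
  ... | t , St , b⊑t = t , St , trans a⊑b b⊑t

module Algebraic {c ℓ₁ ℓ₂ s : Level} (𝒟 : DCPO c ℓ₁ ℓ₂ s) (alg : IsAlgebraic 𝒟) where
  open DCPO 𝒟
  open IsAlgebraic alg

  ⊑⨆K↓ : ∀ z → z ⊑ ⨆ (K↓ z) (K↓-directed z)
  ⊑⨆K↓ z = proj₂ (K↓-sup z) _ (proj₁ (⨆-isSup (K↓ z) (K↓-directed z)))

  ≪⇒compact-between : ∀ {y z} → _≪_ 𝒟 y z →
                      Σ D λ k → IsCompact 𝒟 k × (y ⊑ k) × (k ⊑ z)
  ≪⇒compact-between {z = z} y≪z with y≪z (K↓ z) (K↓-directed z) (⊑⨆K↓ z)
  ... | k , k∈K↓z , y⊑k with proj₁ (K↓-spec z k) k∈K↓z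
  ...   | k-compact , k⊑z = k , k-compact , y⊑k , k⊑z

  ≪⇒⊑ : ∀ {y z} → _≪_ 𝒟 y z → y ⊑ z
  ≪⇒⊑ y≪z with ≪⇒compact-between y≪z
  ... | _ , _ , y⊑k , k⊑z = trans y⊑k k⊑z

module Sharp {c ℓ₁ ℓ₂ s : Level} (𝒟 : DCPO c ℓ₁ ℓ₂ s) (alg : IsAlgebraic 𝒟) where
  open DCPO 𝒟
  open WayBelow 𝒟
  open Algebraic 𝒟 alg

  sharp⇒compact-⊑-decidable : ∀ {x} → IsSharp 𝒟 x →
                              (k : D) → IsCompact 𝒟 k → Dec (k ⊑ x)
  sharp⇒compact-⊑-decidable x-sharp k k≪k =
    [ (λ k≪x → yes (≪⇒⊑ k≪x)) , no ]′ (x-sharp k k k≪k)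

  compact-⊑-decidable⇒sharp : ∀ {x} → ((k : D) → IsCompact 𝒟 k → Dec (k ⊑ x)) →
                              IsSharp 𝒟 x
  compact-⊑-decidable⇒sharp decide y z y≪z with ≪⇒compact-between y≪z
  ... | k , k≪k , y⊑k , k⊑z with decide k k≪k
  ...   | yes k⊑x = inj₁ (⊑-≪-⊑-trans y⊑k k≪k k⊑x)
  ...   | no k⋢x = inj₂ (λ z⊑x → k⋢x (trans k⊑z z⊑x))

proposition5p11 : {c ℓ₁ ℓ₂ s : Level} (𝒟 : DCPO c ℓ₁ ℓ₂ s) → IsAlgebraic 𝒟 →
    (x : DCPO.D 𝒟) →
    IsSharp 𝒟 x ⇔ ((k : DCPO.D 𝒟) → IsCompact 𝒟 k → Dec (DCPO._⊑_ 𝒟 k x))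
proposition5p11 𝒟 alg x =
  mk⇔ sharp⇒compact-⊑-decidable compact-⊑-decidable⇒sharp
  where open Sharp 𝒟 alg
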